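{- Let $\mathbb{K}=(G,M,I)$ be a formal context and let $\mathbb{S}=[H,N]$ be a reduced Boolean subcontext of dimension $k$ of $\mathbb{K}$. Then $\phi_1(\underline{\mathfrak{B}}(\mathbb{S}))$ is a sub-$\vee$-semilattice of $\underline{\mathfrak{B}}(\mathbb{K})$ and $\phi_2(\underline{\mathfrak{B}}(\mathbb{S}))$ is a sub-$\wedge$-semilattice of $\underline{\mathfrak{B}}(\mathbb{K})$.
   Context: All sets are finite. A formal context $\mathbb{K}=(G,M,I)$ has finite $G$, $M$, $I\subseteq G\times M$; for $A\subseteq G$, $A'$ is the set of attributes common to all objects of $A$, for $B\subseteq M$, $B'$ the set of objects having all attributes of $B$. Formal concepts $(A,B)$ satisfy $A'=B$, $B'=A$ and form the concept lattice $\underline{\mathfrak{B}}(\mathbb{K})$ ordered by extent inclusion. For $H\subseteq G$, $N\subseteq M$, $[H,N]=(H,N,I\cap(H\times N))$, with concepts computed w.r.t. its own incidence. $[H,N]$ is a Boolean subcontext of dimension $k$ if its concept lattice is isomorphic to the concept lattice $\mathfrak{B}(k)$ of the contranominal scale $(\{1,\dots,k\},\{1,\dots,k\},\ne)$; it is reduced if it has no reducible objects or attributes (object $g$ is reducible if there is a set $X$ of objects with $g\notin X$ and $g'=X'$; dually for attributes). For a concept $(A,B)$ of $[H,N]$, $\phi_1(A,B)=(A'',A')$ and $\phi_2(A,B)=(B',B'')$, derivations in $\mathbb{K}$; $\phi_i(\underline{\mathfrak{B}}(\mathbb{S}))$ is the set of images of all concepts of $\mathbb{S}$. A subset of a lattice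 is a sub-$\vee$-semilattice (resp. sub-$\wedge$-semilattice) if it is closed under binary joins (resp. meets) of the lattice. -}

module Defs where

open import Data.Nat using (ℕ)
open import Data.Fin using (Fin)
open import Data.Fin.Subset using (Subset; _∈_; _∉_; _⊆_; ⊤; ⁅_⁆)
open import Data.Bool using (Bool; true)
open import Data.Product using (Σ; ∃; _×_; _,_; proj₁; proj₂)
open import Relation.Binary.PropositionalEquality using (_≡_; _≢_)
open import Relation.Nullary using (¬_)
open import Function.Bundles using (_⇔_)

-- A formal context K = (G, M, I) with G = Fin n, M = Fin m and
-- incidence I (g I m  iff  I g m ≡ true).
Incidence : ℕ → ℕ → Set
Incidence n m = Fin n → Fin m → Bool

module _ {n m : ℕ} (I : Incidence n m) where

  -- Derivations in the subcontext [H,N] (relationally):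
  -- DerObj N A B : B = A' computed in [H,N]  (attributes of N common to all of A)
  DerObj : Subset m → Subset n → Subset m → Set
  DerObj N A B = ∀ j → (j ∈ B) ⇔ ((j ∈ N) × (∀ i → i ∈ A → I i j ≡ true))

  DerAttr : Subset n → Subset m → Subset n → Set
  DerAttr H B A = ∀ i → (i ∈ A) ⇔ ((i ∈ H) × (∀ j → j ∈ B → I i j ≡ true))

  IsConcept : Subset n → Subset m → Subset n → Subset m → Set
  IsConcept H N A B = A ⊆ H × B ⊆ N × DerObj N A B × DerAttr H B A

  Concept : Subset n → Subset m → Set
  Concept H N = Σ (Subset n × Subset m) λ p → IsConcept H N (proj₁ p) (proj₂ p)

  ConceptK : Set
  ConceptK = Concept ⊤ ⊤

  ReducibleObj : Subset n → Subset m → Fin n → Set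
  ReducibleObj H N g = g ∈ H × ∃ λ X → X ⊆ H × g ∉ X ×
    ∃ λ B → DerObj N ⁅ g ⁆ B × DerObj N X B

  ReducibleAttr : Subset n → Subset m → Fin m → Set
  ReducibleAttr H N a = a ∈ N × ∃ λ Y → Y ⊆ N × a ∉ Y ×
    ∃ λ A → DerAttr H ⁅ a ⁆ A × DerAttr H Y A

  Reduced : Subset n → Subset m → Set
  Reduced H N = (∀ g → ¬ ReducibleObj H N g) × (∀ a → ¬ ReducibleAttr H N a)

extent : ∀ {n m} {I : Incidence n m} {H N} → Concept I H N → Subset n
extent c = proj₁ (proj₁ c)

intent : ∀ {n m} {I : Incidence n m} {H N} → Concept I H N → Subset m
intent c = proj₂ (proj₁ c)

_≤C_ : ∀ {n m} {I : Incidence n m} {H N} → Concept I H N → Concept I H N → Set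
x ≤C y = extent x ⊆ extent y

-- Order isomorphism between two concept lattices (concepts are identified
-- by their extents, which determine them).
record ConceptIso {n m n' m'} (I : Incidence n m) (H : Subset n) (N : Subset m)
                  (J : Incidence n' m') (H' : Subset n') (N' : Subset m') : Set where
  field
    to      : Concept I H N → Concept J H' N'
    from    : Concept J H' N' → Concept I H N
    from-to : ∀ x → extent (from (to x)) ≡ extent x
    to-from : ∀ y → extent (to (from y)) ≡ extent y
    mono    : ∀ x y → (x ≤C y) ⇔ (to x ≤C to y)

contranominal : (k : ℕ) → Incidence k k
contranominal k i j with Data.Fin._≟_ i j
... | Relation.Nullary.yes _ = Data.Bool.false
... | Relation.Nullary.no _ = true

IsBooleanSub : ∀ {n m} (I : Incidence n m) → Subset n → Subset m → ℕ → Set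
IsBooleanSub I H N k = ConceptIso I H N (contranominal k) ⊤ ⊤

module _ {n m : ℕ} (I : Incidence n m) (H : Subset n) (N : Subset m) where

  -- c ∈ φ₁(𝔅(S)): c = (A'', A') (derivations in K) for some concept (A,B) of S
  InPhi₁ : ConceptK I → Set
  InPhi₁ c = ∃ λ (s : Concept I H N) →
    DerObj I ⊤ (extent s) (intent c) × DerAttr I ⊤ (intent c) (extent c)

  -- c ∈ φ₂(𝔅(S)): c = (B', B'') (derivations in K) for some concept (A,B) of S
  InPhi₂ : ConceptK I → Set
  InPhi₂ c = ∃ λ (s : Concept I H N) →
    DerAttr I ⊤ (intent s) (extent c) × DerObj I ⊤ (extent c) (intent c)

module _ {n m : ℕ} {I : Incidence n m} where
  IsJoin : ConceptK I → ConceptK I → ConceptK I → Set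
  IsJoin x y z = x ≤C z × y ≤C z × (∀ w → x ≤C w → y ≤C w → z ≤C w)

  IsMeet : ConceptK I → ConceptK I → ConceptK I → Set
  IsMeet x y z = z ≤C x × z ≤C y × (∀ w → w ≤C x → w ≤C y → w ≤C z)

  SubJoinSemilattice : (ConceptK I → Set) → Set
  SubJoinSemilattice P = ∀ x y z → P x → P y → IsJoin x y z → P z

  SubMeetSemilattice : (ConceptK I → Set) → Set
  SubMeetSemilattice P = ∀ x y z → P x → P y → IsMeet x y z → P z

-- Transport the problem into the Boolean lattice 2^k through the isomorphism: there joins
-- and meets of concepts of S are unions and intersections of codes, and the lattice is
-- distributive. If an object i lay in the extent of s ⊔ t but in neither extent, then its
-- object concept γ would lie below s ⊔ t, so γ = (γ ⊓ s) ⊔ (γ ⊓ t) by distributivity, and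
-- the objects of γ ⊓ s and γ ⊓ t would have exactly the attributes of i without containing
-- i: i would be reducible. Hence in a reduced Boolean subcontext the extent of s ⊔ t is the
-- union of the extents, and dually the intent of s ⊓ t is the union of the intents. In K
-- the join of (A₁'', A₁') and (A₂'', A₂') has intent A₁' ∩ A₂' = (A₁ ∪ A₂)', which is
-- therefore φ₁(s ⊔ t); dually for φ₂ and meets.
module Submission where

open import Defs
open import Data.Nat using (ℕ)
open import Data.Bool using (true)
open import Data.Bool.Properties using (T-≡) renaming (_≟_ to _≟ᵇ_)
open import Data.Empty using (⊥-elim)
open import Data.Fin using (Fin; _≟_)
open import Data.Fin.Properties using (all?)
open import Data.Fin.Subset using (Subset; _∈_; _∉_; _⊆_; ⊤; ⁅_⁆; _∪_; _∩_; ∁)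
open import Data.Fin.Subset.Properties
open import Data.Product using (_×_; _,_; proj₁; proj₂)
open import Data.Sum using (inj₁; inj₂; [_,_]′)
open import Data.Vec.Base using (tabulate)
open import Data.Vec.Properties using (lookup∘tabulate; lookup⇒[]=; []=⇒lookup)
open import Function.Bundles using (_⇔_; mk⇔; Equivalence)
open import Relation.Binary.PropositionalEquality using (_≡_; _≢_; refl; sym; trans; subst)
open import Relation.Nullary using (¬_; Dec; yes; no)
open import Relation.Nullary.Decidable using (_×-dec_; _→-dec_; isYes; toWitness; fromWitness)
open import Relation.Unary using (Pred; Decidable)

open Equivalence using (to; from)

decSubset : ∀ {n ℓ} {P : Pred (Fin n) ℓ} → Decidable P → Subset n
decSubset P? = tabulate (λ i → isYes (P? i))

∈-decSubset : ∀ {n ℓ} {P : Pred (Fin n) ℓ} (P? : Decidable P) {i} → i ∈ decSubset P? ⇔ P i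
∈-decSubset P? {i} = mk⇔
  (λ i∈ → toWitness (from T-≡ (trans (sym (lookup∘tabulate _ i)) ([]=⇒lookup i∈))))
  (λ Pi → lookup⇒[]= i _ (trans (lookup∘tabulate _ i) (to T-≡ (fromWitness Pi))))

⁅⁆⊆ : ∀ {n} {x : Fin n} {p} → x ∈ p → ⁅ x ⁆ ⊆ p
⁅⁆⊆ x∈p y∈⁅x⁆ = subst (_∈ _) (sym (x∈⁅y⁆⇒x≡y _ y∈⁅x⁆)) x∈p

∀-⁅⁆ : ∀ {n ℓ} {P : Pred (Fin n) ℓ} {x} → (∀ y → y ∈ ⁅ x ⁆ → P y) ⇔ P x
∀-⁅⁆ {P = P} {x} = mk⇔ (λ h → h x (x∈⁅x⁆ x)) (λ Px y y∈ → subst P (sym (x∈⁅y⁆⇒x≡y x y∈)) Px)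

∪-⊆ : ∀ {n} {p q r : Subset n} → p ⊆ r → q ⊆ r → p ∪ q ⊆ r
∪-⊆ {p = p} {q} p⊆r q⊆r x∈ = [ p⊆r , q⊆r ]′ (x∈p∪q⁻ p q x∈)

module FormalContext {n m : ℕ} (I : Incidence n m) where

  incident? : ∀ i j → Dec (I i j ≡ true)
  incident? i j = I i j ≟ᵇ true

  sharedAttributes : Subset m → Subset n → Subset m
  sharedAttributes N A = decSubset λ j → (j ∈? N) ×-dec all? λ i → (i ∈? A) →-dec incident? i j

  sharedObjects : Subset n → Subset m → Subset n
  sharedObjects H B = decSubset λ i → (i ∈? H) ×-dec all? λ j → (j ∈? B) →-dec incident? i j

  sharedAttributes-derObj : ∀ N A → DerObj I N A (sharedAttributes N A)
  sharedAttributes-derObj N A j = ∈-decSubset _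

  sharedObjects-derAttr : ∀ H B → DerAttr I H B (sharedObjects H B)
  sharedObjects-derAttr H B i = ∈-decSubset _

  module Subcontext (H : Subset n) (N : Subset m) where

    extent⊆ : (c : Concept I H N) → extent c ⊆ H
    extent⊆ (_ , A⊆H , _) = A⊆H

    intent⊆ : (c : Concept I H N) → intent c ⊆ N
    intent⊆ (_ , _ , B⊆N , _) = B⊆N

    derObj : (c : Concept I H N) → DerObj I N (extent c) (intent c)
    derObj (_ , _ , _ , A′ , _) = A′

    derAttr : (c : Concept I H N) → DerAttr I H (intent c) (extent c)
    derAttr (_ , _ , _ , _ , B′) = B′

    incident : (c : Concept I H N) {i : Fin n} {j : Fin m} →
               i ∈ extent c → j ∈ intent c → I i j ≡ true
    incident c {i} {j} i∈ j∈ = proj₂ (to (derAttr c i) i∈) j j∈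

    ∈-extent : (c : Concept I H N) {i : Fin n} →
               i ∈ H → (∀ j → j ∈ intent c → I i j ≡ true) → i ∈ extent c
    ∈-extent c {i} i∈H h = from (derAttr c i) (i∈H , h)

    ∈-intent : (c : Concept I H N) {j : Fin m} →
               j ∈ N → (∀ i → i ∈ extent c → I i j ≡ true) → j ∈ intent c
    ∈-intent c {j} j∈N h = from (derObj c j) (j∈N , h)

    intent⊇⇒≤ : (c d : Concept I H N) → intent d ⊆ intent c → c ≤C d
    intent⊇⇒≤ c d d⊆c i∈c = ∈-extent d (extent⊆ c i∈c) (λ _ j∈d → incident c i∈c (d⊆c j∈d))

    ≤⇒intent⊇ : (c d : Concept I H N) → c ≤C d → intent d ⊆ intent c
    ≤⇒intent⊇ c d c≤d j∈d = ∈-intent c (intent⊆ d j∈d) (λ _ i∈c → incident d (c≤d i∈c) j∈d)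

    conceptOfObjects : (A : Subset n) → A ⊆ H → Concept I H N
    conceptOfObjects A A⊆H =
      (A″ , A′) , (λ i∈A″ → proj₁ (unfold-A″ i∈A″)) , (λ j∈A′ → proj₁ (unfold-A′ j∈A′)) ,
      derObj-A″ , sharedObjects-derAttr H A′
      where
      A′ : Subset m
      A′ = sharedAttributes N A
      A″ : Subset n
      A″ = sharedObjects H A′
      unfold-A′ : ∀ {j} → j ∈ A′ → j ∈ N × (∀ i → i ∈ A → I i j ≡ true)
      unfold-A′ {j} = to (sharedAttributes-derObj N A j)
      unfold-A″ : ∀ {i} → i ∈ A″ → i ∈ H × (∀ j → j ∈ A′ → I i j ≡ true)
      unfold-A″ {i} = to (sharedObjects-derAttr H A′ i)
      A⊆A″ : A ⊆ A″
      A⊆A″ {i} i∈A = from (sharedObjects-derAttr H A′ i)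
        (A⊆H i∈A , λ j j∈A′ → proj₂ (unfold-A′ j∈A′) i i∈A)
      derObj-A″ : DerObj I N A″ A′
      derObj-A″ j = mk⇔
        (λ j∈A′ → proj₁ (unfold-A′ j∈A′) , λ i i∈A″ → proj₂ (unfold-A″ i∈A″) j j∈A′)
        (λ (j∈N , h) → from (sharedAttributes-derObj N A j) (j∈N , λ i i∈A → h i (A⊆A″ i∈A)))

    conceptOfAttributes : (B : Subset m) → B ⊆ N → Concept I H N
    conceptOfAttributes B B⊆N =
      (B′ , B″) , (λ i∈B′ → proj₁ (unfold-B′ i∈B′)) , (λ j∈B″ → proj₁ (unfold-B″ j∈B″)) ,
      sharedAttributes-derObj N B′ , derAttr-B″
      where
      B′ : Subset n
      B′ = sharedObjects H B
      B″ : Subset m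
      B″ = sharedAttributes N B′
      unfold-B′ : ∀ {i} → i ∈ B′ → i ∈ H × (∀ j → j ∈ B → I i j ≡ true)
      unfold-B′ {i} = to (sharedObjects-derAttr H B i)
      unfold-B″ : ∀ {j} → j ∈ B″ → j ∈ N × (∀ i → i ∈ B′ → I i j ≡ true)
      unfold-B″ {j} = to (sharedAttributes-derObj N B′ j)
      B⊆B″ : B ⊆ B″
      B⊆B″ {j} j∈B = from (sharedAttributes-derObj N B′ j)
        (B⊆N j∈B , λ i i∈B′ → proj₂ (unfold-B′ i∈B′) j j∈B)
      derAttr-B″ : DerAttr I H B″ B′
      derAttr-B″ i = mk⇔
        (λ i∈B′ → proj₁ (unfold-B′ i∈B′) , λ j j∈B″ → proj₂ (unfold-B″ j∈B″) i i∈B′)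
        (λ (i∈H , h) → from (sharedObjects-derAttr H B i) (i∈H , λ j j∈B → h j (B⊆B″ j∈B)))

    objectConcept : {i : Fin n} → i ∈ H → Concept I H N
    objectConcept i∈H = conceptOfObjects ⁅ _ ⁆ (⁅⁆⊆ i∈H)

    attributeConcept : {j : Fin m} → j ∈ N → Concept I H N
    attributeConcept j∈N = conceptOfAttributes ⁅ _ ⁆ (⁅⁆⊆ j∈N)

    ∈-extent-objectConcept : {i : Fin n} (i∈H : i ∈ H) → i ∈ extent (objectConcept i∈H)
    ∈-extent-objectConcept {i} i∈H =
      ∈-extent (objectConcept i∈H) i∈H
        (λ j j∈ → to ∀-⁅⁆ (proj₂ (to (sharedAttributes-derObj N ⁅ i ⁆ j) j∈)))

    ∈-intent-attributeConcept : {j : Fin m} (j∈N : j ∈ N) → j ∈ intent (attributeConcept j∈N)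
    ∈-intent-attributeConcept {j} j∈N =
      ∈-intent (attributeConcept j∈N) j∈N
        (λ i i∈ → to ∀-⁅⁆ (proj₂ (to (sharedObjects-derAttr H ⁅ j ⁆ i) i∈)))

    objectConcept-≤ : {i : Fin n} (i∈H : i ∈ H) (t : Concept I H N) →
                      (∀ j → j ∈ intent t → I i j ≡ true) → objectConcept i∈H ≤C t
    objectConcept-≤ {i} i∈H t h = intent⊇⇒≤ (objectConcept i∈H) t λ {j} j∈t →
      from (sharedAttributes-derObj N ⁅ i ⁆ j) (intent⊆ t j∈t , from ∀-⁅⁆ (h j j∈t))

    ∈-extent-attributeConcept⇔ : {i : Fin n} {j : Fin m} (j∈N : j ∈ N) → i ∈ H →
                                 i ∈ extent (attributeConcept j∈N) ⇔ (I i j ≡ true)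
    ∈-extent-attributeConcept⇔ {i} {j} j∈N i∈H = mk⇔
      (λ i∈μ → incident (attributeConcept j∈N) i∈μ (∈-intent-attributeConcept j∈N))
      (λ Iij → from (sharedObjects-derAttr H ⁅ j ⁆ i) (i∈H , from ∀-⁅⁆ Iij))

    ≤-attributeConcept : {j : Fin m} (j∈N : j ∈ N) (t : Concept I H N) →
                         (∀ i → i ∈ extent t → I i j ≡ true) → t ≤C attributeConcept j∈N
    ≤-attributeConcept j∈N t h i∈t =
      from (∈-extent-attributeConcept⇔ j∈N (extent⊆ t i∈t)) (h _ i∈t)

    reducibleObj : {i : Fin n} {X : Subset n} → i ∈ H → X ⊆ H → i ∉ X →
                   (∀ j → j ∈ N → (∀ x → x ∈ X → I x j ≡ true) ⇔ (I i j ≡ true)) →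
                   ReducibleObj I H N i
    reducibleObj {i} {X} i∈H X⊆H i∉X same =
      i∈H , X , X⊆H , i∉X , i′ , sharedAttributes-derObj N ⁅ i ⁆ , derObj-X
      where
      i′ : Subset m
      i′ = sharedAttributes N ⁅ i ⁆
      derObj-X : DerObj I N X i′
      derObj-X j = mk⇔
        (λ j∈i′ → let (j∈N , h) = to (sharedAttributes-derObj N ⁅ i ⁆ j) j∈i′
                  in j∈N , from (same j j∈N) (to ∀-⁅⁆ h))
        (λ (j∈N , h) → from (sharedAttributes-derObj N ⁅ i ⁆ j)
                          (j∈N , from ∀-⁅⁆ (to (same j j∈N) h)))

    reducibleAttr : {a : Fin m} {Y : Subset m} → a ∈ N → Y ⊆ N → a ∉ Y →
                    (∀ i → i ∈ H → (∀ y → y ∈ Y → I i y ≡ true) ⇔ (I i a ≡ true)) →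
                    ReducibleAttr I H N a
    reducibleAttr {a} {Y} a∈N Y⊆N a∉Y same =
      a∈N , Y , Y⊆N , a∉Y , a′ , sharedObjects-derAttr H ⁅ a ⁆ , derAttr-Y
      where
      a′ : Subset n
      a′ = sharedObjects H ⁅ a ⁆
      derAttr-Y : DerAttr I H Y a′
      derAttr-Y i = mk⇔
        (λ i∈a′ → let (i∈H , h) = to (sharedObjects-derAttr H ⁅ a ⁆ i) i∈a′
                  in i∈H , from (same i i∈H) (to ∀-⁅⁆ h))
        (λ (i∈H , h) → from (sharedObjects-derAttr H ⁅ a ⁆ i)
                          (i∈H , from ∀-⁅⁆ (to (same i i∈H) h)))

contranominal-≢ : ∀ {k} {i j : Fin k} → i ≢ j → contranominal k i j ≡ true
contranominal-≢ {i = i} {j} i≢j with i ≟ j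
... | yes i≡j = ⊥-elim (i≢j i≡j)
... | no _ = refl

contranominal-refl : ∀ {k} (i : Fin k) → contranominal k i i ≢ true
contranominal-refl i with i ≟ i
... | yes _ = λ ()
... | no i≢i = ⊥-elim (i≢i refl)

contranominalConcept : ∀ {k} (E : Subset k) → Concept (contranominal k) ⊤ ⊤
contranominalConcept {k} E = (E , ∁ E) , (λ _ → ∈⊤) , (λ _ → ∈⊤) , derObj-E , derAttr-∁E
  where
  derObj-E : DerObj (contranominal k) ⊤ E (∁ E)
  derObj-E j = mk⇔
    (λ j∈∁E → ∈⊤ , λ i i∈E → contranominal-≢ λ i≡j →
      x∈∁p⇒x∉p j∈∁E (subst (_∈ E) i≡j i∈E))
    (λ (_ , h) → x∉p⇒x∈∁p λ j∈E → contranominal-refl j (h j j∈E))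
  derAttr-∁E : DerAttr (contranominal k) ⊤ (∁ E) E
  derAttr-∁E i = mk⇔
    (λ i∈E → ∈⊤ , λ j j∈∁E → contranominal-≢ λ i≡j →
      x∈∁p⇒x∉p j∈∁E (subst (_∈ E) i≡j i∈E))
    (λ (_ , h) → x∉∁p⇒x∈p λ i∈∁E → contranominal-refl i (h i i∈∁E))

module BooleanSubcontext {n m k : ℕ} {I : Incidence n m} {H : Subset n} {N : Subset m}
                         (boolean : IsBooleanSub I H N k) where
  open FormalContext I
  open Subcontext H N
  private module Iso = ConceptIso boolean

  code : Concept I H N → Subset k
  code c = extent (Iso.to c)

  decode : Subset k → Concept I H N
  decode E = Iso.from (contranominalConcept E)

  ∈-code-decode : ∀ {E x} → x ∈ code (decode E) ⇔ x ∈ E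
  ∈-code-decode {E} = mk⇔ (subst (_ ∈_) eq) (subst (_ ∈_) (sym eq))
    where
    eq : code (decode E) ≡ E
    eq = Iso.to-from (contranominalConcept E)

  decode-≤ : ∀ {E} d → E ⊆ code d → decode E ≤C d
  decode-≤ d E⊆d = from (Iso.mono _ d) (λ x∈ → E⊆d (to ∈-code-decode x∈))

  ≤-decode : ∀ {E} c → code c ⊆ E → c ≤C decode E
  ≤-decode c c⊆E = from (Iso.mono c _) (λ x∈ → from ∈-code-decode (c⊆E x∈))

  code-mono : ∀ c d → c ≤C d → code c ⊆ code d
  code-mono c d = to (Iso.mono c d)

  infixr 30 _⊔_
  infixr 31 _⊓_

  _⊔_ : Concept I H N → Concept I H N → Concept I H N
  c ⊔ d = decode (code c ∪ code d)

  _⊓_ : Concept I H N → Concept I H N → Concept I H N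
  c ⊓ d = decode (code c ∩ code d)

  x≤x⊔y : ∀ c d → c ≤C c ⊔ d
  x≤x⊔y c d = ≤-decode c (p⊆p∪q (code d))

  y≤x⊔y : ∀ c d → d ≤C c ⊔ d
  y≤x⊔y c d = ≤-decode d (q⊆p∪q (code c) (code d))

  ⊔-least : ∀ c d e → c ≤C e → d ≤C e → c ⊔ d ≤C e
  ⊔-least c d e c≤e d≤e = decode-≤ e (∪-⊆ (code-mono c e c≤e) (code-mono d e d≤e))

  x⊓y≤x : ∀ c d → c ⊓ d ≤C c
  x⊓y≤x c d = decode-≤ c (p∩q⊆p (code c) (code d))

  x⊓y≤y : ∀ c d → c ⊓ d ≤C d
  x⊓y≤y c d = decode-≤ d (p∩q⊆q (code c) (code d))

  ⊓-greatest : ∀ c d e → e ≤C c → e ≤C d → e ≤C c ⊓ d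
  ⊓-greatest c d e e≤c e≤d =
    ≤-decode e (λ x∈ → x∈p∩q⁺ (code-mono e c e≤c x∈ , code-mono e d e≤d x∈))

  ⊓-distrib-⊔-≤ : ∀ c d e → c ≤C d ⊔ e → c ≤C c ⊓ d ⊔ c ⊓ e
  ⊓-distrib-⊔-≤ c d e c≤d⊔e = ≤-decode c λ x∈c →
    x∈p∪q⁺ ([ (λ x∈d → inj₁ (from ∈-code-decode (x∈p∩q⁺ (x∈c , x∈d))))
            , (λ x∈e → inj₂ (from ∈-code-decode (x∈p∩q⁺ (x∈c , x∈e)))) ]′
      (x∈p∪q⁻ _ _ (to ∈-code-decode (code-mono c (d ⊔ e) c≤d⊔e x∈c))))

  ⊔-distrib-⊓-≥ : ∀ c d e → d ⊓ e ≤C c → (c ⊔ d) ⊓ (c ⊔ e) ≤C c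
  ⊔-distrib-⊓-≥ c d e d⊓e≤c = decode-≤ c λ x∈ →
    let (x∈c⊔d , x∈c⊔e) = x∈p∩q⁻ _ _ x∈ in
    [ (λ x∈c → x∈c)
    , (λ x∈d → [ (λ x∈c → x∈c)
               , (λ x∈e → code-mono (d ⊓ e) c d⊓e≤c (from ∈-code-decode (x∈p∩q⁺ (x∈d , x∈e)))) ]′
                 (x∈p∪q⁻ _ _ (to ∈-code-decode x∈c⊔e))) ]′
      (x∈p∪q⁻ _ _ (to ∈-code-decode x∈c⊔d))

  reducibleObj-⊔ : ∀ c d {i} → i ∈ extent (c ⊔ d) → i ∉ extent c → i ∉ extent d →
                   ReducibleObj I H N i
  reducibleObj-⊔ c d {i} i∈c⊔d i∉c i∉d =
    reducibleObj i∈H X⊆H i∉X (λ j j∈N → mk⇔ (⇒ j∈N) (⇐ j∈N))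
    where
    i∈H : i ∈ H
    i∈H = extent⊆ (c ⊔ d) i∈c⊔d
    γ : Concept I H N
    γ = objectConcept i∈H
    X : Subset n
    X = extent (γ ⊓ c) ∪ extent (γ ⊓ d)
    X⊆H : X ⊆ H
    X⊆H = ∪-⊆ (extent⊆ (γ ⊓ c)) (extent⊆ (γ ⊓ d))
    i∉γ⊓ : ∀ e → i ∉ extent e → i ∉ extent (γ ⊓ e)
    i∉γ⊓ e i∉e i∈γ⊓e = i∉e (x⊓y≤y γ e i∈γ⊓e)
    i∉X : i ∉ X
    i∉X i∈X = [ i∉γ⊓ c i∉c , i∉γ⊓ d i∉d ]′ (x∈p∪q⁻ (extent (γ ⊓ c)) (extent (γ ⊓ d)) i∈X)
    ⇒ : ∀ {j} (j∈N : j ∈ N) → (∀ x → x ∈ X → I x j ≡ true) → I i j ≡ true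
    ⇒ {j} j∈N h = to (∈-extent-attributeConcept⇔ j∈N i∈H) (γ≤μ (∈-extent-objectConcept i∈H))
      where
      μ : Concept I H N
      μ = attributeConcept j∈N
      γ⊓-≤μ : ∀ e → (∀ x → x ∈ extent (γ ⊓ e) → x ∈ X) → γ ⊓ e ≤C μ
      γ⊓-≤μ e ⊆X = ≤-attributeConcept j∈N (γ ⊓ e) (λ x x∈ → h x (⊆X x x∈))
      γ≤μ : γ ≤C μ
      γ≤μ = ⊆-trans
        (⊓-distrib-⊔-≤ γ c d (objectConcept-≤ i∈H (c ⊔ d) (λ _ → incident (c ⊔ d) i∈c⊔d)))
        (⊔-least (γ ⊓ c) (γ ⊓ d) μ (γ⊓-≤μ c (λ _ x∈ → x∈p∪q⁺ (inj₁ x∈)))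
                                   (γ⊓-≤μ d (λ _ x∈ → x∈p∪q⁺ (inj₂ x∈))))
    ⇐ : ∀ {j} (j∈N : j ∈ N) → I i j ≡ true → ∀ x → x ∈ X → I x j ≡ true
    ⇐ {j} j∈N Iij x x∈X = incident γ (X⊆γ x∈X) (≤⇒intent⊇ γ μ γ≤μ (∈-intent-attributeConcept j∈N))
      where
      μ : Concept I H N
      μ = attributeConcept j∈N
      X⊆γ : X ⊆ extent γ
      X⊆γ = ∪-⊆ (x⊓y≤x γ c) (x⊓y≤x γ d)
      γ≤μ : γ ≤C μ
      γ≤μ = objectConcept-≤ i∈H μ (λ _ → incident μ (from (∈-extent-attributeConcept⇔ j∈N i∈H) Iij))

  reducibleAttr-⊓ : ∀ c d {a} → a ∈ intent (c ⊓ d) → a ∉ intent c → a ∉ intent d →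
                    ReducibleAttr I H N a
  reducibleAttr-⊓ c d {a} a∈c⊓d a∉c a∉d =
    reducibleAttr a∈N Y⊆N a∉Y (λ i i∈H → mk⇔ (⇒ i∈H) (⇐ i∈H))
    where
    a∈N : a ∈ N
    a∈N = intent⊆ (c ⊓ d) a∈c⊓d
    μ : Concept I H N
    μ = attributeConcept a∈N
    Y : Subset m
    Y = intent (μ ⊔ c) ∪ intent (μ ⊔ d)
    Y⊆N : Y ⊆ N
    Y⊆N = ∪-⊆ (intent⊆ (μ ⊔ c)) (intent⊆ (μ ⊔ d))
    a∉μ⊔ : ∀ e → a ∉ intent e → a ∉ intent (μ ⊔ e)
    a∉μ⊔ e a∉e a∈μ⊔e = a∉e (≤⇒intent⊇ e (μ ⊔ e) (y≤x⊔y μ e) a∈μ⊔e)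
    a∉Y : a ∉ Y
    a∉Y a∈Y = [ a∉μ⊔ c a∉c , a∉μ⊔ d a∉d ]′ (x∈p∪q⁻ (intent (μ ⊔ c)) (intent (μ ⊔ d)) a∈Y)

    ⇒ : ∀ {i} (i∈H : i ∈ H) → (∀ y → y ∈ Y → I i y ≡ true) → I i a ≡ true
    ⇒ {i} i∈H h = to (∈-extent-attributeConcept⇔ a∈N i∈H) (γ≤μ (∈-extent-objectConcept i∈H))
      where
      γ : Concept I H N
      γ = objectConcept i∈H
      γ≤μ⊔ : ∀ e → (∀ y → y ∈ intent (μ ⊔ e) → y ∈ Y) → γ ≤C μ ⊔ e
      γ≤μ⊔ e ⊆Y = objectConcept-≤ i∈H (μ ⊔ e) (λ y y∈ → h y (⊆Y y y∈))
      c⊓d≤μ : c ⊓ d ≤C μ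
      c⊓d≤μ = ≤-attributeConcept a∈N (c ⊓ d) (λ _ i∈ → incident (c ⊓ d) i∈ a∈c⊓d)
      γ≤μ : γ ≤C μ
      γ≤μ = ⊆-trans
        (⊓-greatest (μ ⊔ c) (μ ⊔ d) γ (γ≤μ⊔ c (λ _ y∈ → x∈p∪q⁺ (inj₁ y∈)))
                                      (γ≤μ⊔ d (λ _ y∈ → x∈p∪q⁺ (inj₂ y∈))))
        (⊔-distrib-⊓-≥ μ c d c⊓d≤μ)

    ⇐ : ∀ {i} (i∈H : i ∈ H) → I i a ≡ true → ∀ y → y ∈ Y → I i y ≡ true
    ⇐ {i} i∈H Iia y y∈Y = incident μ (from (∈-extent-attributeConcept⇔ a∈N i∈H) Iia) (Y⊆μ y∈Y)
      where
      Y⊆μ : Y ⊆ intent μ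
      Y⊆μ = ∪-⊆ (≤⇒intent⊇ μ (μ ⊔ c) (x≤x⊔y μ c)) (≤⇒intent⊇ μ (μ ⊔ d) (x≤x⊔y μ d))

  extent-⊔ : (∀ g → ¬ ReducibleObj I H N g) → ∀ c d → extent (c ⊔ d) ⊆ extent c ∪ extent d
  extent-⊔ irreducible c d {i} i∈c⊔d with i ∈? extent c | i ∈? extent d
  ... | yes i∈c | _       = x∈p∪q⁺ (inj₁ i∈c)
  ... | no _    | yes i∈d = x∈p∪q⁺ (inj₂ i∈d)
  ... | no i∉c  | no i∉d  = ⊥-elim (irreducible i (reducibleObj-⊔ c d i∈c⊔d i∉c i∉d))

  intent-⊓ : (∀ a → ¬ ReducibleAttr I H N a) → ∀ c d → intent (c ⊓ d) ⊆ intent c ∪ intent d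
  intent-⊓ irreducible c d {a} a∈c⊓d with a ∈? intent c | a ∈? intent d
  ... | yes a∈c | _       = x∈p∪q⁺ (inj₁ a∈c)
  ... | no _    | yes a∈d = x∈p∪q⁺ (inj₂ a∈d)
  ... | no a∉c  | no a∉d  = ⊥-elim (irreducible a (reducibleAttr-⊓ c d a∈c⊓d a∉c a∉d))

module _ {n m : ℕ} {I : Incidence n m} where
  open FormalContext I
  open Subcontext ⊤ ⊤

  intent-join : ∀ {A B W : Subset n} (x y z : ConceptK I) →
                DerObj I ⊤ A (intent x) → DerObj I ⊤ B (intent y) → IsJoin x y z →
                A ⊆ W → B ⊆ W → W ⊆ A ∪ B → DerObj I ⊤ W (intent z)
  intent-join {A} {B} {W} x y z A′ B′ (x≤z , y≤z , least) A⊆W B⊆W W⊆A∪B j = mk⇔ ⇒ ⇐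
    where
    ⊆extent : ∀ {C} c → DerObj I ⊤ C (intent c) → C ⊆ extent c
    ⊆extent c C′ i∈C = ∈-extent c ∈⊤ (λ j j∈c → proj₂ (to (C′ j) j∈c) _ i∈C)

    W⊆z : W ⊆ extent z
    W⊆z i∈W = [ (λ i∈A → x≤z (⊆extent x A′ i∈A)) , (λ i∈B → y≤z (⊆extent y B′ i∈B)) ]′
                (x∈p∪q⁻ A B (W⊆A∪B i∈W))

    ⇒ : j ∈ intent z → j ∈ ⊤ × (∀ i → i ∈ W → I i j ≡ true)
    ⇒ j∈z = ∈⊤ , λ _ i∈W → incident z (W⊆z i∈W) j∈z

    ⇐ : j ∈ ⊤ × (∀ i → i ∈ W → I i j ≡ true) → j ∈ intent z
    ⇐ (_ , h) = ≤⇒intent⊇ z μ (least μ (≤μ x A′ A⊆W) (≤μ y B′ B⊆W)) (∈-intent-attributeConcept ∈⊤)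
      where
      μ : ConceptK I
      μ = attributeConcept (∈⊤ {x = j})
      ≤μ : ∀ {C} c → DerObj I ⊤ C (intent c) → C ⊆ W → c ≤C μ
      ≤μ c C′ C⊆W = ≤-attributeConcept ∈⊤ c λ _ i∈c →
        incident c i∈c (from (C′ j) (∈⊤ , λ i i∈C → h i (C⊆W i∈C)))

  extent-meet : ∀ {A B W : Subset m} (x y z : ConceptK I) →
                DerAttr I ⊤ A (extent x) → DerAttr I ⊤ B (extent y) → IsMeet x y z →
                A ⊆ W → B ⊆ W → W ⊆ A ∪ B → DerAttr I ⊤ W (extent z)
  extent-meet {A} {B} {W} x y z A′ B′ (z≤x , z≤y , greatest) A⊆W B⊆W W⊆A∪B i = mk⇔ ⇒ ⇐
    where
    ⊆intent : ∀ {C} c → DerAttr I ⊤ C (extent c) → C ⊆ intent c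
    ⊆intent c C′ j∈C = ∈-intent c ∈⊤ (λ i i∈c → proj₂ (to (C′ i) i∈c) _ j∈C)

    W⊆z : W ⊆ intent z
    W⊆z j∈W = [ (λ j∈A → ≤⇒intent⊇ z x z≤x (⊆intent x A′ j∈A))
              , (λ j∈B → ≤⇒intent⊇ z y z≤y (⊆intent y B′ j∈B)) ]′
                (x∈p∪q⁻ A B (W⊆A∪B j∈W))

    ⇒ : i ∈ extent z → i ∈ ⊤ × (∀ j → j ∈ W → I i j ≡ true)
    ⇒ i∈z = ∈⊤ , λ _ j∈W → incident z i∈z (W⊆z j∈W)

    ⇐ : i ∈ ⊤ × (∀ j → j ∈ W → I i j ≡ true) → i ∈ extent z
    ⇐ (_ , h) = greatest γ (γ≤ x A′ A⊆W) (γ≤ y B′ B⊆W) (∈-extent-objectConcept ∈⊤)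
      where
      γ : ConceptK I
      γ = objectConcept (∈⊤ {x = i})
      γ≤ : ∀ {C} c → DerAttr I ⊤ C (extent c) → C ⊆ W → γ ≤C c
      γ≤ c C′ C⊆W = objectConcept-≤ ∈⊤ c λ _ j∈c →
        incident c (from (C′ i) (∈⊤ , λ j j∈C → h j (C⊆W j∈C))) j∈c

lemma9 : ∀ {n m} (I : Incidence n m) (H : Subset n) (N : Subset m) (k : ℕ) →
    Reduced I H N → IsBooleanSub I H N k →
    SubJoinSemilattice (InPhi₁ I H N) × SubMeetSemilattice (InPhi₂ I H N)
lemma9 I H N k (irreducibleObj , irreducibleAttr) boolean = joins , meets
  where
  open BooleanSubcontext boolean
  module S = FormalContext.Subcontext I H N
  module K = FormalContext.Subcontext I ⊤ ⊤

  joins : SubJoinSemilattice (InPhi₁ I H N)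
  joins x y z (s , s′ , _) (t , t′ , _) z-join =
    s ⊔ t ,
    intent-join x y z s′ t′ z-join (x≤x⊔y s t) (y≤x⊔y s t) (extent-⊔ irreducibleObj s t) ,
    K.derAttr z

  meets : SubMeetSemilattice (InPhi₂ I H N)
  meets x y z (s , s′ , _) (t , t′ , _) z-meet =
    s ⊓ t ,
    extent-meet x y z s′ t′ z-meet (S.≤⇒intent⊇ (s ⊓ t) s (x⊓y≤x s t))
                                 (S.≤⇒intent⊇ (s ⊓ t) t (x⊓y≤y s t))
                                 (intent-⊓ irreducibleAttr s t) ,
    K.derObj z
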